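{- For any graphs $G$ and $H$, $\gamma(G\diamond H)=1$ if and only if $\gamma(G)=1=\gamma(H)$.
   Context: All graphs are finite, simple and undirected. The modular product $G\diamond H$ has vertex set $V(G)\times V(H)$, and two distinct vertices $(g,h)$ and $(g',h')$ are adjacent iff either ($g=g'$ and $hh'\in E(H)$), or ($gg'\in E(G)$ and $h=h'$), or ($gg'\in E(G)$ and $hh'\in E(H)$), or ($g\neq g'$, $h\neq h'$, $gg'\notin E(G)$ and $hh'\notin E(H)$). $\gamma(G)$ denotes the domination number of $G$ (minimum size of a set $D$ such that every vertex outside $D$ has a neighbor in $D$). -}

module Defs where

open import Data.Nat using (ℕ; _*_; _≤_)
open import Data.Fin using (Fin; remQuot)
open import Data.Fin.Subset using (Subset; _∈_; ∣_∣)
open import Data.Product using (Σ; ∃; _×_; _,_; proj₁; proj₂)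
open import Data.Sum using (_⊎_)
open import Relation.Nullary using (¬_)
open import Relation.Binary.PropositionalEquality using (_≡_; _≢_)

record Graph (n : ℕ) : Set₁ where
  field
    Adj   : Fin n → Fin n → Set
    sym   : ∀ {x y} → Adj x y → Adj y x
    irrefl : ∀ {x} → ¬ Adj x x
open Graph public

Dominating : ∀ {n} → Graph n → Subset n → Set
Dominating {n} G D = ∀ (v : Fin n) → ¬ (v ∈ D) → ∃ λ u → u ∈ D × Adj G v u

DominationNumber : ∀ {n} → Graph n → ℕ → Set
DominationNumber G k =
  (∃ λ D → Dominating G D × ∣ D ∣ ≡ k) × (∀ D → Dominating G D → k ≤ ∣ D ∣)

ModAdj : ∀ {m n} → Graph m → Graph n → Fin m × Fin n → Fin m × Fin n → Set
ModAdj G H (g , h) (g' , h') =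
     (g ≡ g' × Adj H h h')
  ⊎ (Adj G g g' × h ≡ h')
  ⊎ (Adj G g g' × Adj H h h')
  ⊎ (g ≢ g' × h ≢ h' × ¬ Adj G g g' × ¬ Adj H h h')

-- The modular product G ◇ H, with vertex set Fin (m * n) ≅ Fin m × Fin n
-- (identified via remQuot).
_◇_ : ∀ {m n} → Graph m → Graph n → Graph (m * n)
_◇_ {m} {n} G H = record
  { Adj = λ x y → ModAdj G H (remQuot n x) (remQuot n y)
  ; sym = symP
  ; irrefl = irr
  }
  where
  open import Data.Sum using (inj₁; inj₂)
  open import Relation.Binary.PropositionalEquality using (refl) renaming (sym to ≡sym)
  symP : ∀ {x y} → ModAdj G H x y → ModAdj G H y x
  symP (inj₁ (e , a)) = inj₁ (≡sym e , Graph.sym H a)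
  symP (inj₂ (inj₁ (a , e))) = inj₂ (inj₁ (Graph.sym G a , ≡sym e))
  symP (inj₂ (inj₂ (inj₁ (a , b)))) = inj₂ (inj₂ (inj₁ (Graph.sym G a , Graph.sym H b)))
  symP (inj₂ (inj₂ (inj₂ (p , q , a , b)))) =
    inj₂ (inj₂ (inj₂ ((λ e → p (≡sym e)) , (λ e → q (≡sym e)) ,
      (λ z → a (Graph.sym G z)) , (λ z → b (Graph.sym H z)))))
  irr : ∀ {x} → ¬ ModAdj G H x x
  irr (inj₁ (_ , a)) = Graph.irrefl H a
  irr (inj₂ (inj₁ (a , _))) = Graph.irrefl G a
  irr (inj₂ (inj₂ (inj₁ (a , _)))) = Graph.irrefl G a
  irr (inj₂ (inj₂ (inj₂ (p , _)))) = p refl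

{-# OPTIONS --safe #-}
module Submission where

-- γ(G) = 1 says exactly that G has a universal vertex, one adjacent to all
-- others. In the modular product, (g , h) is universal iff g and h are: a
-- vertex (g' , h) with g' ≠ g can only be joined to (g , h) by an edge of G,
-- and symmetrically for (g , h'); conversely, if g and h are universal, every
-- other vertex is joined to (g , h) by one of the first three clauses.

open import Defs hiding (sym)
open import Data.Nat using (_<_; z≤n)
open import Data.Nat.Properties using (≤-<-trans; <-irrefl)
open import Data.Product using (_×_; _,_; proj₁; proj₂; ∃; uncurry)
open import Data.Product.Function.NonDependent.Propositional using (_×-⇔_)
open import Data.Sum using (inj₁; inj₂)
open import Data.Fin using (Fin; remQuot; combine; _≟_)
open import Data.Fin.Properties
  using (remQuot-combine; combine-remQuot; combine-injective; combine-surjective)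
open import Data.Fin.Subset using (Subset; _∈_; _⊆_; ∣_∣; ⁅_⁆; Nonempty)
open import Data.Fin.Subset.Properties
  using ( x∈⁅x⁆; x∈⁅y⁆⇒x≡y; ∣⁅x⁆∣≡1; ∣⊥∣≡0; ⊆-antisym; p⊂q⇒∣p∣<∣q∣
        ; x∈p⇒∣p-x∣<∣p∣; nonempty?; Empty-unique; _∈?_)
open import Relation.Nullary using (yes; no; contradiction)
open import Relation.Binary.PropositionalEquality
  using (_≡_; _≢_; refl; sym; trans; cong; cong₂; subst; subst₂)
open import Function.Base using (_∘_)
open import Function.Bundles using (_⇔_; mk⇔; Equivalence)
open import Function.Construct.Symmetry using (⇔-sym)
open import Function.Related.Propositional using (module EquationalReasoning)

Universal : ∀ {A : Set} → (A → A → Set) → A → Set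
Universal R u = ∀ v → v ≢ u → R v u

nonempty⇒0<∣p∣ : ∀ {n} {p : Subset n} → Nonempty p → 0 < ∣ p ∣
nonempty⇒0<∣p∣ (x , x∈p) = ≤-<-trans z≤n (x∈p⇒∣p-x∣<∣p∣ x∈p)

∣p∣≡1⇒p≡⁅x⁆ : ∀ {n} {p : Subset n} → ∣ p ∣ ≡ 1 → ∃ λ x → p ≡ ⁅ x ⁆
∣p∣≡1⇒p≡⁅x⁆ {n} {p} ∣p∣≡1 with nonempty? p
... | no p-empty with () ← trans (sym ∣p∣≡1) (trans (cong ∣_∣ (Empty-unique p-empty)) (∣⊥∣≡0 n))
... | yes (x , x∈p) = x , ⊆-antisym p⊆⁅x⁆ ⁅x⁆⊆p
  where
  ⁅x⁆⊆p : ⁅ x ⁆ ⊆ p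
  ⁅x⁆⊆p y∈⁅x⁆ = subst (_∈ p) (sym (x∈⁅y⁆⇒x≡y x y∈⁅x⁆)) x∈p

  p⊆⁅x⁆ : p ⊆ ⁅ x ⁆
  p⊆⁅x⁆ {y} y∈p with y ≟ x
  ... | yes refl = x∈⁅x⁆ x
  ... | no y≢x = contradiction
    (subst₂ _<_ (∣⁅x⁆∣≡1 x) ∣p∣≡1 (p⊂q⇒∣p∣<∣q∣ (⁅x⁆⊆p , y , y∈p , y≢x ∘ x∈⁅y⁆⇒x≡y x)))
    (<-irrefl refl)

module _ {n} (G : Graph n) where

  dominating⇒nonempty : ∀ {D} → Dominating G D → Fin n → Nonempty D
  dominating⇒nonempty {D} dom x with x ∈? D
  ... | yes x∈D = x , x∈D
  ... | no x∉D with w , w∈D , _ ← dom x x∉D = w , w∈D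

  dominating-⁅u⁆⇔universal : ∀ {u} → Dominating G ⁅ u ⁆ ⇔ Universal (Adj G) u
  dominating-⁅u⁆⇔universal {u} = mk⇔ to from
    where
    to : Dominating G ⁅ u ⁆ → Universal (Adj G) u
    to dom v v≢u with w , w∈⁅u⁆ , v~w ← dom v (v≢u ∘ x∈⁅y⁆⇒x≡y u) =
      subst (Adj G v) (x∈⁅y⁆⇒x≡y u w∈⁅u⁆) v~w

    from : Universal (Adj G) u → Dominating G ⁅ u ⁆
    from universal v v∉⁅u⁆ = u , x∈⁅x⁆ u , universal v λ { refl → v∉⁅u⁆ (x∈⁅x⁆ u) }

  dominationNumber≡1⇔∃universal : DominationNumber G 1 ⇔ ∃ (Universal (Adj G))
  dominationNumber≡1⇔∃universal = mk⇔ to from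
    where
    to : DominationNumber G 1 → ∃ (Universal (Adj G))
    to ((D , dom , ∣D∣≡1) , _) with u , refl ← ∣p∣≡1⇒p≡⁅x⁆ {p = D} ∣D∣≡1 =
      u , Equivalence.to dominating-⁅u⁆⇔universal dom

    from : ∃ (Universal (Adj G)) → DominationNumber G 1
    from (u , universal) =
      (⁅ u ⁆ , Equivalence.from dominating-⁅u⁆⇔universal universal , ∣⁅x⁆∣≡1 u) ,
      λ D dom → nonempty⇒0<∣p∣ (dominating⇒nonempty dom u)

universal-remQuot⇔ : ∀ {m n} (R : Fin m × Fin n → Fin m × Fin n → Set) {g h} →
  Universal (λ x y → R (remQuot n x) (remQuot n y)) (combine g h) ⇔ Universal R (g , h)
universal-remQuot⇔ {m} {n} R {g} {h} = mk⇔ to from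
  where
  to : Universal (λ x y → R (remQuot n x) (remQuot n y)) (combine g h) → Universal R (g , h)
  to universal (g' , h') g'h'≢gh =
    subst₂ R (remQuot-combine g' h') (remQuot-combine g h)
      (universal (combine g' h') (g'h'≢gh ∘ uncurry (cong₂ _,_) ∘ combine-injective g' h' g h))

  from : Universal R (g , h) → Universal (λ x y → R (remQuot n x) (remQuot n y)) (combine g h)
  from universal x x≢gh =
    subst (R (remQuot n x)) (sym (remQuot-combine g h))
      (universal (remQuot n x) (x≢gh ∘ trans (sym (combine-remQuot {m} n x)) ∘ cong (uncurry combine)))

module _ {m n} (G : Graph m) (H : Graph n) where

  modAdj⇒adjᴳ : ∀ {g g' h} → g' ≢ g → ModAdj G H (g' , h) (g , h) → Adj G g' g
  modAdj⇒adjᴳ g'≢g (inj₁ (g'≡g , _))                  = contradiction g'≡g g'≢g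
  modAdj⇒adjᴳ g'≢g (inj₂ (inj₁ (g'~g , _)))           = g'~g
  modAdj⇒adjᴳ g'≢g (inj₂ (inj₂ (inj₁ (g'~g , _))))    = g'~g
  modAdj⇒adjᴳ g'≢g (inj₂ (inj₂ (inj₂ (_ , h≢h , _)))) = contradiction refl h≢h

  modAdj⇒adjᴴ : ∀ {g h h'} → h' ≢ h → ModAdj G H (g , h') (g , h) → Adj H h' h
  modAdj⇒adjᴴ h'≢h (inj₁ (_ , h'~h))                  = h'~h
  modAdj⇒adjᴴ h'≢h (inj₂ (inj₁ (_ , h'≡h)))           = contradiction h'≡h h'≢h
  modAdj⇒adjᴴ h'≢h (inj₂ (inj₂ (inj₁ (_ , h'~h))))    = h'~h
  modAdj⇒adjᴴ h'≢h (inj₂ (inj₂ (inj₂ (g≢g , _))))     = contradiction refl g≢g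

  universal-modAdj⇔ : ∀ {g h} →
    Universal (ModAdj G H) (g , h) ⇔ (Universal (Adj G) g × Universal (Adj H) h)
  universal-modAdj⇔ {g} {h} = mk⇔ to from
    where
    to : Universal (ModAdj G H) (g , h) → Universal (Adj G) g × Universal (Adj H) h
    to universal =
      (λ g' g'≢g → modAdj⇒adjᴳ g'≢g (universal (g' , h) (g'≢g ∘ cong proj₁))) ,
      (λ h' h'≢h → modAdj⇒adjᴴ h'≢h (universal (g , h') (h'≢h ∘ cong proj₂)))

    from : Universal (Adj G) g × Universal (Adj H) h → Universal (ModAdj G H) (g , h)
    from (universalᴳ , universalᴴ) (g' , h') g'h'≢gh with g' ≟ g | h' ≟ h
    ... | yes g'≡g | yes h'≡h = contradiction (cong₂ _,_ g'≡g h'≡h) g'h'≢gh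
    ... | yes g'≡g | no h'≢h  = inj₁ (g'≡g , universalᴴ h' h'≢h)
    ... | no g'≢g  | yes h'≡h = inj₂ (inj₁ (universalᴳ g' g'≢g , h'≡h))
    ... | no g'≢g  | no h'≢h  = inj₂ (inj₂ (inj₁ (universalᴳ g' g'≢g , universalᴴ h' h'≢h)))

  ∃universal-◇⇔ : ∃ (Universal (Adj (G ◇ H))) ⇔ (∃ (Universal (Adj G)) × ∃ (Universal (Adj H)))
  ∃universal-◇⇔ = mk⇔ to from
    where
    to : ∃ (Universal (Adj (G ◇ H))) → ∃ (Universal (Adj G)) × ∃ (Universal (Adj H))
    to (x , universal) with g , h , refl ← combine-surjective {m} {n} x
      with universalᴳ , universalᴴ ← Equivalence.to universal-modAdj⇔
             (Equivalence.to (universal-remQuot⇔ (ModAdj G H)) universal)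
      = (g , universalᴳ) , (h , universalᴴ)

    from : ∃ (Universal (Adj G)) × ∃ (Universal (Adj H)) → ∃ (Universal (Adj (G ◇ H)))
    from ((g , universalᴳ) , (h , universalᴴ)) =
      combine g h ,
      Equivalence.from (universal-remQuot⇔ (ModAdj G H))
        (Equivalence.from universal-modAdj⇔ (universalᴳ , universalᴴ))

proposition22 : ∀ {m n} (G : Graph m) (H : Graph n) →
    DominationNumber (G ◇ H) 1 ⇔ (DominationNumber G 1 × DominationNumber H 1)
proposition22 G H = begin
  DominationNumber (G ◇ H) 1
    ∼⟨ dominationNumber≡1⇔∃universal (G ◇ H) ⟩
  ∃ (Universal (Adj (G ◇ H)))
    ∼⟨ ∃universal-◇⇔ G H ⟩
  (∃ (Universal (Adj G)) × ∃ (Universal (Adj H)))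
    ∼⟨ ⇔-sym (dominationNumber≡1⇔∃universal G ×-⇔ dominationNumber≡1⇔∃universal H) ⟩
  (DominationNumber G 1 × DominationNumber H 1)
    ∎
  where open EquationalReasoning
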